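{- Let $m \leq n$ be positive integers and let $D$ be a dominating set of $Q_{m \times n}$ with $|D| \leq m-2$. Let $m'$ be the number of rows and $n'$ the number of columns of the box of $D$. If $m' > n'$ then $|D| \geq \lceil n/2 \rceil$. If $m' \leq n'$ then $|D| \geq \left\lceil \frac{n-1-(n'-m')}{2} \right\rceil$.
   Context: The $m \times n$ chessboard has squares $(x,y)$ with $1 \le x \le n$ (column $x$) and $1 \le y \le m$ (row $y$). The queens graph $Q_{m \times n}$ has these squares as vertices; two distinct squares are adjacent if they lie in the same row, the same column, the same difference diagonal (same value of $y-x$) or the same sum diagonal (same value of $y+x$). A set $D$ of squares is a dominating set if every square is in $D$ or adjacent to a square of $D$. For a set $D$ of squares with $m \le n$ and $|D| \le m-2$, let $a$ and $b$ be the smallest and largest indices of columns containing no square of $D$, and $c$ and $d$ the smallest and largest indices of rows containing no square of $D$. The box of $D$ is the sub-board $\{(x,y): a \le x \le b,\ c \le y \le d\}$; it has $m' = d-c+1$ rows and $n' = b-a+1$ columns. -}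

module Defs where

open import Data.Nat using (ℕ; _+_; _≤_)
open import Data.Product using (_×_; _,_; ∃-syntax)
open import Data.Sum using (_⊎_)
open import Data.List using (List)
open import Data.List.Membership.Propositional using (_∈_; _∉_)
open import Relation.Binary.PropositionalEquality using (_≡_; _≢_)

-- A square is (x , y): column x, row y.
Square : Set
Square = ℕ × ℕ

OnBoard : ℕ → ℕ → Square → Set
OnBoard m n (x , y) = (1 ≤ x × x ≤ n) × (1 ≤ y × y ≤ m)

-- Two distinct squares are adjacent in the queens graph iff they share a row,
-- a column, a difference diagonal (y - x equal, written y + x' = y' + x to
-- stay in ℕ) or a sum diagonal (x + y equal).
Adjacent : Square → Square → Set
Adjacent (x , y) (x' , y') =
  (x , y) ≢ (x' , y') ×
  (y ≡ y' ⊎ x ≡ x' ⊎ y + x' ≡ y' + x ⊎ y + x ≡ y' + x')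

Dominating : ℕ → ℕ → List Square → Set
Dominating m n D = ∀ s → OnBoard m n s → s ∈ D ⊎ (∃[ t ] (t ∈ D × Adjacent s t))

EmptyCol : List Square → ℕ → Set
EmptyCol D x = ∀ y → (x , y) ∉ D

EmptyRow : List Square → ℕ → Set
EmptyRow D y = ∀ x → (x , y) ∉ D

IsMinEmptyCol : ℕ → List Square → ℕ → Set
IsMinEmptyCol n D a = (1 ≤ a × a ≤ n) × EmptyCol D a ×
  (∀ x → 1 ≤ x → x ≤ n → EmptyCol D x → a ≤ x)

IsMaxEmptyCol : ℕ → List Square → ℕ → Set
IsMaxEmptyCol n D b = (1 ≤ b × b ≤ n) × EmptyCol D b ×
  (∀ x → 1 ≤ x → x ≤ n → EmptyCol D x → x ≤ b)

IsMinEmptyRow : ℕ → List Square → ℕ → Set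
IsMinEmptyRow m D c = (1 ≤ c × c ≤ m) × EmptyRow D c ×
  (∀ y → 1 ≤ y → y ≤ m → EmptyRow D y → c ≤ y)

IsMaxEmptyRow : ℕ → List Square → ℕ → Set
IsMaxEmptyRow m D d = (1 ≤ d × d ≤ m) × EmptyRow D d ×
  (∀ y → 1 ≤ y → y ≤ m → EmptyRow D y → y ≤ d)

-- Let E be the set of empty columns, δ = d − c, k = |D| and n′ = b − a + 1.
-- For x ∈ E the squares (x, c) and (x, d) lie in an empty row and an empty
-- column, so each is dominated along a diagonal. As (x, c) shares its difference
-- diagonal with (x + δ, d), and (x, d) its sum diagonal with (x + δ, c), every
-- x ∈ E puts a queen on the difference diagonal through (x, d) or (x + δ, d), and
-- one on the sum diagonal through (x, c) or (x + δ, c). A queen lies on one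
-- diagonal of each kind, and a diagonal is reached from two columns only for
-- columns in E ∩ (E + δ) ⊆ [a + δ, b]; hence 2|E| ≤ 2k + 2(n′ − δ). The other
-- n − |E| columns each hold a queen, so n ≤ 2k + (n′ − δ), giving both bounds.

module Submission where

open import Defs
open import Data.Nat using (ℕ; _+_; _∸_; _≤_; _>_; ⌈_/2⌉)
open import Data.Product using (_×_)
open import Data.List using (List; length)
open import Data.List.Relation.Unary.All using (All)
open import Data.List.Relation.Unary.Unique.Propositional using (Unique)

open import Data.Nat using (zero; suc; _<_; _⊓_; _≡ᵇ_; _≤ᵇ_; z≤n; s≤s)
open import Data.Nat.Properties
open import Data.Bool using (Bool; true; false; T; _∧_; _∨_; not; if_then_else_)
open import Data.Bool.Properties using (T-∧; T-∨; ∧-distribˡ-∨)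
open import Data.Unit using (tt)
open import Data.Empty using (⊥; ⊥-elim)
open import Data.Product using (_,_; proj₁; proj₂)
open import Data.Sum using (_⊎_; inj₁; inj₂)
open import Data.List using ([]; _∷_)
open import Data.Bool.ListAction using (any)
open import Data.List.Membership.Propositional using (lose)
import Data.List.Relation.Unary.Any as Any
open import Data.List.Relation.Unary.Any.Properties using (any⁺; any⁻)
open import Function.Base using (_∘_)
open import Function.Bundles using (Equivalence)
open import Relation.Binary.PropositionalEquality
open import Algebra.Properties.CommutativeSemigroup +-commutativeSemigroup
  using (interchange; xy∙z≈xz∙y)

open Equivalence using (to; from)

count : (ℕ → Bool) → ℕ → ℕ
count p zero    = 0
count p (suc N) = if p N then suc (count p N) else count p N

AtMostOne : (ℕ → Bool) → Set
AtMostOne p = ∀ x y → T (p x) → T (p y) → x ≡ y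

private variable
  p q : ℕ → Bool
  N : ℕ

count-cong : (∀ x → p x ≡ q x) → ∀ N → count p N ≡ count q N
count-cong p≗q zero    = refl
count-cong p≗q (suc N) =
  cong₂ (λ b c → if b then suc c else c) (p≗q N) (count-cong p≗q N)

count-mono : (∀ x → x < N → T (p x) → T (q x)) → count p N ≤ count q N
count-mono {N = zero}          p⇒q = z≤n
count-mono {N = suc N} {p} {q} p⇒q
  with p N in eqp | q N in eqq | count-mono {N} {p} {q} (λ x x<N → p⇒q x (m<n⇒m<1+n x<N))
... | true  | true  | ih = s≤s ih
... | true  | false | _  = ⊥-elim (subst T eqq (p⇒q N ≤-refl (subst T (sym eqp) tt)))
... | false | true  | ih = m≤n⇒m≤1+n ih
... | false | false | ih = ih

count-∨+count-∧ : ∀ N → count (λ x → p x ∨ q x) N + count (λ x → p x ∧ q x) N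
                       ≡ count p N + count q N
count-∨+count-∧         zero    = refl
count-∨+count-∧ {p} {q} (suc N) with p N | q N | count-∨+count-∧ {p} {q} N
... | true  | true  | ih = cong suc (trans (+-suc _ _) (trans (cong suc ih) (sym (+-suc (count p N) _))))
... | true  | false | ih = cong suc ih
... | false | true  | ih = trans (cong suc ih) (sym (+-suc (count p N) _))
... | false | false | ih = ih

count-∨ : ∀ N → count (λ x → p x ∨ q x) N ≤ count p N + count q N
count-∨ {p} {q} N =
  ≤-trans (m≤m+n _ _) (≤-reflexive (count-∨+count-∧ {p} {q} N))

count-shift : ∀ δ N → count p (N + δ) ≡ count (λ z → p (z + δ)) N + count p δ
count-shift     δ zero    = refl
count-shift {p} δ (suc N) with p (N + δ)
... | true  = cong suc (count-shift δ N)
... | false = count-shift δ N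

count-≡0 : (∀ x → x < N → T (p x) → ⊥) → count p N ≡ 0
count-≡0 {N = zero}      _     = refl
count-≡0 {N = suc N} {p} never with p N in eq
... | true  = ⊥-elim (never N ≤-refl (subst T (sym eq) tt))
... | false = count-≡0 (λ x x<N → never x (m<n⇒m<1+n x<N))

count-atMostOne : AtMostOne p → ∀ N → count p N ≤ 1
count-atMostOne     unique zero    = z≤n
count-atMostOne {p} unique (suc N) with p N in eq
... | true  = s≤s (≤-reflexive (count-≡0 λ x x<N px →
                <-irrefl (unique x N px (subst T (sym eq) tt)) x<N))
... | false = count-atMostOne unique N

count-cover : ∀ {r : ℕ → Bool} → (∀ x → x < N → T (p x) → T (q x ∨ r x)) →
              count p N ≤ count (λ x → p x ∧ q x) N + count (λ x → p x ∧ r x) N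
count-cover {N} {p} {q} {r} covered =
  ≤-trans (count-mono {N} {p} {λ x → (p x ∧ q x) ∨ (p x ∧ r x)} restrict) (count-∨ N)
  where
  restrict : ∀ x → x < N → T (p x) → T ((p x ∧ q x) ∨ (p x ∧ r x))
  restrict x x<N px = subst T (∧-distribˡ-∨ (p x) (q x) (r x))
    (from (T-∧ {p x} {q x ∨ r x}) (px , covered x x<N px))

count-any : {A : Set} (R : A → ℕ → Bool) → (∀ a → AtMostOne (R a)) →
            ∀ (xs : List A) N → count (λ x → any (λ a → R a x) xs) N ≤ length xs
count-any R unique []       N = ≤-reflexive (count-≡0 {N} {λ _ → false} λ _ _ ())
count-any R unique (a ∷ xs) N = ≤-trans (count-∨ {R a} N)
  (+-mono-≤ (count-atMostOne (unique a) N) (count-any R unique xs N))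

count-interval : ∀ {lo hi} → (∀ y → T (p y) → lo ≤ y × y < hi) →
                 ∀ N → count p N ≤ hi ∸ lo
count-interval {p} {lo} {hi} inside N =
  ≤-trans (capped N) (∸-monoˡ-≤ lo (m⊓n≤n N hi))
  where
  capped : ∀ N → count p N ≤ (N ⊓ hi) ∸ lo
  capped zero    = z≤n
  capped (suc N) with p N in eq
  ... | false = ≤-trans (capped N) (∸-monoˡ-≤ lo (⊓-monoˡ-≤ hi (n≤1+n N)))
  ... | true  = begin
    suc (count p N)       ≤⟨ s≤s (capped N) ⟩
    suc ((N ⊓ hi) ∸ lo)   ≡⟨ cong (λ z → suc (z ∸ lo)) (m≤n⇒m⊓n≡m (<⇒≤ N<hi)) ⟩
    suc (N ∸ lo)          ≡⟨ sym (+-∸-assoc 1 lo≤N) ⟩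
    suc N ∸ lo            ≡⟨ cong (_∸ lo) (sym (m≤n⇒m⊓n≡m N<hi)) ⟩
    (suc N ⊓ hi) ∸ lo     ∎
    where
    open ≤-Reasoning
    lo≤N = proj₁ (inside N (subst T (sym eq) tt))
    N<hi = proj₂ (inside N (subst T (sym eq) tt))

positives⇒≤count : (∀ x → 1 ≤ x → x ≤ N → T (p x)) → N ≤ count p (suc N)
positives⇒≤count {N = zero}      _   = z≤n
positives⇒≤count {N = suc N} {p} all with p (suc N) in eq
... | true  = s≤s (positives⇒≤count (λ x 1≤x x≤N → all x 1≤x (m≤n⇒m≤1+n x≤N)))
... | false = ⊥-elim (subst T eq (all (suc N) (s≤s z≤n) ≤-refl))

shiftedBy : ℕ → (ℕ → Bool) → ℕ → Bool
shiftedBy δ p y = (δ ≤ᵇ y) ∧ p (y ∸ δ)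

shiftedBy-+ : ∀ δ p z → shiftedBy δ p (z + δ) ≡ p z
shiftedBy-+ δ p z rewrite m+n∸n≡m z δ with δ ≤ᵇ z + δ in eq
... | true  = refl
... | false = ⊥-elim (subst T eq (≤⇒≤ᵇ (m≤n+m δ z)))

count-shifted-overlap : ∀ δ N →
  count (λ x → p x ∧ q (x + δ)) N + count (λ x → p x ∧ q x) N
    ≤ count q (N + δ) + count (λ y → shiftedBy δ p y ∧ p y) (N + δ)
count-shifted-overlap {p} {q} δ N = begin
  count (λ x → p x ∧ q (x + δ)) N + count (λ x → p x ∧ q x) N
    ≤⟨ +-mono-≤ shifted extended ⟩
  count (λ y → s y ∧ q y) M + count (λ y → p y ∧ q y) M
    ≡⟨ sym (count-∨+count-∧ M) ⟩
  count (λ y → (s y ∧ q y) ∨ (p y ∧ q y)) M + count (λ y → (s y ∧ q y) ∧ (p y ∧ q y)) M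
    ≤⟨ +-mono-≤ (count-mono {M} {λ y → (s y ∧ q y) ∨ (p y ∧ q y)} λ y _ → either (s y) (p y) (q y))
                 (count-mono {M} {λ y → (s y ∧ q y) ∧ (p y ∧ q y)} λ y _ → both (s y) (p y) (q y)) ⟩
  count q M + count (λ y → s y ∧ p y) M ∎
  where
  open ≤-Reasoning
  s = shiftedBy δ p
  M = N + δ
  shifted : count (λ x → p x ∧ q (x + δ)) N ≤ count (λ y → s y ∧ q y) M
  shifted = begin
    count (λ x → p x ∧ q (x + δ)) N
      ≡⟨ count-cong (λ z → cong (_∧ q (z + δ)) (sym (shiftedBy-+ δ p z))) N ⟩
    count (λ z → s (z + δ) ∧ q (z + δ)) N
      ≤⟨ m≤m+n _ _ ⟩
    count (λ z → s (z + δ) ∧ q (z + δ)) N + count (λ y → s y ∧ q y) δ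
      ≡⟨ sym (count-shift δ N) ⟩
    count (λ y → s y ∧ q y) M ∎
  extended : count (λ y → p y ∧ q y) N ≤ count (λ y → p y ∧ q y) M
  extended = ≤-trans (m≤n+m _ _)
    (≤-reflexive (trans (sym (count-shift N δ)) (cong (count _) (+-comm δ N))))
  either : ∀ a b c → T ((a ∧ c) ∨ (b ∧ c)) → T c
  either a b c h with to (T-∨ {a ∧ c} {b ∧ c}) h
  ... | inj₁ ac = proj₂ (to (T-∧ {a} {c}) ac)
  ... | inj₂ bc = proj₂ (to (T-∧ {b} {c}) bc)
  both : ∀ a b c → T ((a ∧ c) ∧ (b ∧ c)) → T (a ∧ b)
  both a b c h with to (T-∧ {a ∧ c} {b ∧ c}) h
  ... | ac , bc = from (T-∧ {a} {b}) (proj₁ (to (T-∧ {a} {c}) ac) , proj₁ (to (T-∧ {b} {c}) bc))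

m+m≤n+n⇒m≤n : ∀ {m n} → m + m ≤ n + n → m ≤ n
m+m≤n+n⇒m≤n {m} {n} le =
  subst₂ _≤_ (sym (n≡⌊n+n/2⌋ m)) (sym (n≡⌊n+n/2⌋ n)) (⌊n/2⌋-mono le)

m≤n+n⇒⌈m/2⌉≤n : ∀ {m n} → m ≤ n + n → ⌈ m /2⌉ ≤ n
m≤n+n⇒⌈m/2⌉≤n {m} {n} le = subst (⌈ m /2⌉ ≤_) (sym (n≡⌈n+n/2⌉ n)) (⌈n/2⌉-mono le)

m∸n≤1+m∸[n+1] : ∀ m n → m ∸ n ≤ suc (m ∸ (n + 1))
m∸n≤1+m∸[n+1] m n = m≤n+o⇒m∸n≤o m n
  (subst (m ≤_) (+-assoc n 1 (m ∸ (n + 1))) (m≤n+m∸n m (n + 1)))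

onDiffDiagonal : Square → Square → Bool
onDiffDiagonal (x , y) (x′ , y′) = y + x′ ≡ᵇ y′ + x

onSumDiagonal : Square → Square → Bool
onSumDiagonal (x , y) (x′ , y′) = y + x ≡ᵇ y′ + x′

onDiffDiagonal-translate : ∀ δ {x y} t → T (onDiffDiagonal (x , y) t) →
                           T (onDiffDiagonal (x + δ , y + δ) t)
onDiffDiagonal-translate δ {x} {y} (x′ , y′) on = ≡⇒≡ᵇ _ _ (begin
  y + δ + x′    ≡⟨ xy∙z≈xz∙y y δ x′ ⟩
  y + x′ + δ    ≡⟨ cong (_+ δ) (≡ᵇ⇒≡ _ _ on) ⟩
  y′ + x + δ    ≡⟨ +-assoc y′ x δ ⟩
  y′ + (x + δ)  ∎)
  where open ≡-Reasoning

onSumDiagonal-translate : ∀ δ {x y} t → T (onSumDiagonal (x , y + δ) t) →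
                          T (onSumDiagonal (x + δ , y) t)
onSumDiagonal-translate δ {x} {y} (x′ , y′) on = ≡⇒≡ᵇ _ _ (begin
  y + (x + δ)  ≡⟨ sym (+-assoc y x δ) ⟩
  y + x + δ    ≡⟨ xy∙z≈xz∙y y x δ ⟩
  y + δ + x    ≡⟨ ≡ᵇ⇒≡ _ _ on ⟩
  y′ + x′      ∎)
  where open ≡-Reasoning

any-mono : ∀ {A : Set} {p q : A → Bool} {xs} → (∀ a → T (p a) → T (q a)) →
           T (any p xs) → T (any q xs)
any-mono {p = p} {q} {xs} p⇒q = any⁺ q ∘ Any.map (p⇒q _) ∘ any⁻ p xs

dominated-diagonally : ∀ {m n D x y} → Dominating m n D → OnBoard m n (x , y) →
  EmptyCol D x → EmptyRow D y →
  T (any (onDiffDiagonal (x , y)) D) ⊎ T (any (onSumDiagonal (x , y)) D)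
dominated-diagonally dom onBoard emptyCol emptyRow with dom _ onBoard
... | inj₁ mem = ⊥-elim (emptyCol _ mem)
... | inj₂ ((x′ , _) , mem , _ , inj₁ refl) = ⊥-elim (emptyRow x′ mem)
... | inj₂ ((_ , y′) , mem , _ , inj₂ (inj₁ refl)) = ⊥-elim (emptyCol y′ mem)
... | inj₂ (_ , mem , _ , inj₂ (inj₂ (inj₁ diff))) = inj₁ (any⁺ _ (lose mem (≡⇒≡ᵇ _ _ diff)))
... | inj₂ (_ , mem , _ , inj₂ (inj₂ (inj₂ sum))) = inj₂ (any⁺ _ (lose mem (≡⇒≡ᵇ _ _ sum)))

module EmptyColumns {m n : ℕ} {D : List Square} (dom : Dominating m n D)
  {a b c d : ℕ} (ha : IsMinEmptyCol n D a) (hb : IsMaxEmptyCol n D b)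
  (hc : IsMinEmptyRow m D c) (hd : IsMaxEmptyRow m D d) where

  k δ : ℕ
  k = length D
  δ = d ∸ c

  d≡c+δ : d ≡ c + δ
  d≡c+δ = sym (m+[n∸m]≡n (proj₂ (proj₂ hd) c (proj₁ (proj₁ hc)) (proj₂ (proj₁ hc)) (proj₁ (proj₂ hc))))

  occupied empty diffOccupied sumOccupied : ℕ → Bool
  occupied x     = any (λ t → proj₁ t ≡ᵇ x) D
  empty x        = (1 ≤ᵇ x) ∧ ((x ≤ᵇ n) ∧ not (occupied x))
  diffOccupied x = any (onDiffDiagonal (x , d)) D
  sumOccupied x  = any (onSumDiagonal (x , c)) D

  empty-spec : ∀ x → T (empty x) → (1 ≤ x × x ≤ n) × EmptyCol D x
  empty-spec x e with 1 ≤ᵇ x in lo | x ≤ᵇ n in hi | occupied x in occ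
  empty-spec x () | false | _     | _
  empty-spec x () | true  | false | _
  empty-spec x () | true  | true  | true
  empty-spec x _  | true  | true  | false =
    (≤ᵇ⇒≤ 1 x (subst T (sym lo) tt) , ≤ᵇ⇒≤ x n (subst T (sym hi) tt)) ,
    λ y mem → subst T occ (any⁺ _ (lose mem (≡⇒≡ᵇ x x refl)))

  empty-or-occupied : ∀ x → 1 ≤ x → x ≤ n → T (empty x ∨ occupied x)
  empty-or-occupied x 1≤x x≤n = either-way (occupied x) (≤⇒≤ᵇ 1≤x) (≤⇒≤ᵇ x≤n)
    where
    either-way : ∀ {u v} o → T u → T v → T ((u ∧ (v ∧ not o)) ∨ o)
    either-way {true} {true} true  _ _ = tt
    either-way {true} {true} false _ _ = tt

  row-c-covered : ∀ x → T (empty x) → T (diffOccupied (x + δ) ∨ sumOccupied x)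
  row-c-covered x e with empty-spec x e
  ... | onCol , emptyCol
    with dominated-diagonally dom (onCol , proj₁ hc) emptyCol (proj₁ (proj₂ hc))
  ... | inj₁ diag = from (T-∨ {diffOccupied (x + δ)}) (inj₁
    (subst (λ r → T (any (onDiffDiagonal (x + δ , r)) D)) (sym d≡c+δ)
      (any-mono {xs = D} (onDiffDiagonal-translate δ {x} {c}) diag)))
  ... | inj₂ diag = from (T-∨ {diffOccupied (x + δ)}) (inj₂ diag)

  row-d-covered : ∀ x → T (empty x) → T (diffOccupied x ∨ sumOccupied (x + δ))
  row-d-covered x e with empty-spec x e
  ... | onCol , emptyCol
    with dominated-diagonally dom (onCol , proj₁ hd) emptyCol (proj₁ (proj₂ hd))
  ... | inj₁ diag = from (T-∨ {diffOccupied x}) (inj₁ diag)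
  ... | inj₂ diag = from (T-∨ {diffOccupied x}) (inj₂
    (any-mono {xs = D} (onSumDiagonal-translate δ {x} {c})
      (subst (λ r → T (any (onSumDiagonal (x , r)) D)) d≡c+δ diag)))

  n⁺ M w : ℕ
  n⁺ = suc n
  M = n⁺ + δ
  w = (b ∸ a + 1) ∸ δ

  count-occupied : count occupied n⁺ ≤ k
  count-occupied = count-any (λ t x → proj₁ t ≡ᵇ x)
    (λ (x′ , _) x y tx ty → trans (sym (≡ᵇ⇒≡ x′ x tx)) (≡ᵇ⇒≡ x′ y ty)) D n⁺

  count-diffOccupied : count diffOccupied M ≤ k
  count-diffOccupied = count-any (λ t x → onDiffDiagonal (x , d) t)
    (λ (x′ , y′) x y tx ty →
      +-cancelˡ-≡ y′ x y (trans (sym (≡ᵇ⇒≡ (d + x′) _ tx)) (≡ᵇ⇒≡ (d + x′) _ ty))) D M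

  count-sumOccupied : count sumOccupied M ≤ k
  count-sumOccupied = count-any (λ t x → onSumDiagonal (x , c) t)
    (λ (x′ , y′) x y tx ty →
      +-cancelˡ-≡ c x y (trans (≡ᵇ⇒≡ _ (y′ + x′) tx) (sym (≡ᵇ⇒≡ _ (y′ + x′) ty)))) D M

  overlaps : ℕ → Bool
  overlaps y = shiftedBy δ empty y ∧ empty y

  count-overlap : count overlaps M ≤ w
  count-overlap = subst (count overlaps M ≤_) width (count-interval {overlaps} inside M)
    where
    a≤b : a ≤ b
    a≤b = proj₂ (proj₂ hb) a (proj₁ (proj₁ ha)) (proj₂ (proj₁ ha)) (proj₁ (proj₂ ha))
    maximal : ∀ y → T (empty y) → y ≤ b
    maximal y e = let (1≤y , y≤n) , col = empty-spec y e in proj₂ (proj₂ hb) y 1≤y y≤n col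
    minimal : ∀ y → T (empty y) → a ≤ y
    minimal y e = let (1≤y , y≤n) , col = empty-spec y e in proj₂ (proj₂ ha) y 1≤y y≤n col
    inside : ∀ y → T (overlaps y) → a + δ ≤ y × y < suc b
    inside y h with to (T-∧ {shiftedBy δ empty y}) h
    ... | shifted , e with to (T-∧ {δ ≤ᵇ y}) shifted
    ... | δ≤y , e′ = subst (a + δ ≤_) (m∸n+n≡m (≤ᵇ⇒≤ δ y δ≤y)) (+-monoˡ-≤ δ (minimal (y ∸ δ) e′)) ,
                     s≤s (maximal y e)
    width : suc b ∸ (a + δ) ≡ w
    width = begin
      suc b ∸ (a + δ)    ≡⟨ sym (∸-+-assoc (suc b) a δ) ⟩
      suc b ∸ a ∸ δ      ≡⟨ cong (_∸ δ) (+-∸-assoc 1 a≤b) ⟩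
      suc (b ∸ a) ∸ δ    ≡⟨ cong (_∸ δ) (+-comm 1 (b ∸ a)) ⟩
      w                  ∎
      where open ≡-Reasoning

  empty-bound : count empty n⁺ ≤ k + w
  empty-bound = m+m≤n+n⇒m≤n (begin
    count empty n⁺ + count empty n⁺
      ≤⟨ +-mono-≤
           (count-cover {n⁺} {empty} {diffOccupied ∘ (_+ δ)} {sumOccupied} λ x _ → row-c-covered x)
           (count-cover {n⁺} {empty} {diffOccupied} {sumOccupied ∘ (_+ δ)} λ x _ → row-d-covered x) ⟩
    (diff⁺ + sum) + (diff + sum⁺)
      ≡⟨ trans (interchange diff⁺ sum diff sum⁺) (cong (diff⁺ + diff +_) (+-comm sum sum⁺)) ⟩
    (diff⁺ + diff) + (sum⁺ + sum)
      ≤⟨ +-mono-≤ (count-shifted-overlap {empty} {diffOccupied} δ n⁺)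
                  (count-shifted-overlap {empty} {sumOccupied} δ n⁺) ⟩
    (count diffOccupied M + count overlaps M) + (count sumOccupied M + count overlaps M)
      ≤⟨ +-mono-≤ (+-mono-≤ count-diffOccupied count-overlap)
                  (+-mono-≤ count-sumOccupied count-overlap) ⟩
    (k + w) + (k + w) ∎)
    where
    open ≤-Reasoning
    diff⁺ diff sum⁺ sum : ℕ
    diff⁺ = count (λ x → empty x ∧ diffOccupied (x + δ)) n⁺
    diff  = count (λ x → empty x ∧ diffOccupied x) n⁺
    sum⁺  = count (λ x → empty x ∧ sumOccupied (x + δ)) n⁺
    sum   = count (λ x → empty x ∧ sumOccupied x) n⁺

  columns-bound : n ≤ (k + k) + w
  columns-bound = begin
    n                                      ≤⟨ positives⇒≤count empty-or-occupied ⟩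
    count (λ x → empty x ∨ occupied x) n⁺  ≤⟨ count-∨ {empty} {occupied} n⁺ ⟩
    count empty n⁺ + count occupied n⁺     ≤⟨ +-mono-≤ empty-bound count-occupied ⟩
    (k + w) + k                            ≡⟨ xy∙z≈xz∙y k w k ⟩
    (k + k) + w                            ∎
    where open ≤-Reasoning

proposition4 : (m n : ℕ) → 1 ≤ m → m ≤ n →
    (D : List Square) → Unique D → All (OnBoard m n) D →
    Dominating m n D → length D ≤ m ∸ 2 →
    (a b c d : ℕ) →
    IsMinEmptyCol n D a → IsMaxEmptyCol n D b →
    IsMinEmptyRow m D c → IsMaxEmptyRow m D d →
    ((d ∸ c + 1) > (b ∸ a + 1) → ⌈ n /2⌉ ≤ length D) ×
    ((d ∸ c + 1) ≤ (b ∸ a + 1) →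
      ⌈ (n ∸ 1 ∸ ((b ∸ a + 1) ∸ (d ∸ c + 1))) /2⌉ ≤ length D)
-- None of 1 ≤ m, m ≤ n, |D| ≤ m − 2 and the distinctness of the queens is needed;
-- the second bound holds even without m′ ≤ n′.
proposition4 m n _ _ D _ _ dom _ a b c d ha hb hc hd = tall , wide
  where
  open EmptyColumns dom ha hb hc hd using (k; δ; w; columns-bound)
  n′ = b ∸ a + 1

  tall : δ + 1 > n′ → ⌈ n /2⌉ ≤ k
  tall n′<δ+1 = m≤n+n⇒⌈m/2⌉≤n (≤-trans columns-bound
    (≤-reflexive (trans (cong (k + k +_) w≡0) (+-identityʳ (k + k)))))
    where
    w≡0 : w ≡ 0
    w≡0 = m≤n⇒m∸n≡0 (m<1+n⇒m≤n (subst (n′ <_) (+-comm δ 1) n′<δ+1))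

  wide : δ + 1 ≤ n′ → ⌈ (n ∸ 1 ∸ (n′ ∸ (δ + 1))) /2⌉ ≤ k
  wide _ = m≤n+n⇒⌈m/2⌉≤n (subst (_≤ k + k) (sym (∸-+-assoc n 1 s))
    (m≤n+o⇒m∸n≤o n (suc s) (≤-trans columns-bound (begin
      (k + k) + w        ≤⟨ +-monoʳ-≤ (k + k) (m∸n≤1+m∸[n+1] n′ δ) ⟩
      (k + k) + suc s    ≡⟨ +-comm (k + k) (suc s) ⟩
      suc s + (k + k)    ∎))))
    where
    open ≤-Reasoning
    s = n′ ∸ (δ + 1)
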